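{- If $D$ is a digraph of order $n$, then $dc(D)+dc(D^c)\le n+1$.
   Context: All digraphs are finite, without loops; symmetric arcs (2-cycles) are permitted. The complement $D^c$ of $D$ is the digraph on $V(D)$ in which, for distinct $u,v$, $uv$ is an arc iff $uv$ is not an arc of $D$. A (vertex) coloring is acyclic if each chromatic class induces a subdigraph with no directed cycle. The dichromatic number $dc(D)$ is the smallest $k$ such that $D$ has an acyclic coloring with $k$ colors. -}

module Defs where

open import Data.Nat using (ℕ; suc; _≤_; _≥_)
open import Data.Fin using (Fin)
open import Data.Bool using (Bool; true; false; not)
open import Data.List using (List; []; _∷_; length; lookup)
open import Data.List.Relation.Unary.Unique.Propositional using (Unique)
open import Data.List.Relation.Unary.All using (All)
open import Data.Product using (Σ; _×_; ∃)
open import Relation.Binary.PropositionalEquality using (_≡_; _≢_)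
open import Relation.Nullary using (¬_)
open import Data.Unit using (⊤)
open import Data.Empty using (⊥)

-- Loops are not allowed: the value adj u u is ignored everywhere
-- (Arc requires u ≢ v).  Symmetric arcs (2-cycles) are permitted.
record Digraph (n : ℕ) : Set where
  field
    adj : Fin n → Fin n → Bool

open Digraph public

Arc : ∀ {n} → Digraph n → Fin n → Fin n → Set
Arc D u v = (u ≢ v) × (adj D u v ≡ true)

complement : ∀ {n} → Digraph n → Digraph n
complement D = record { adj = λ u v → not (adj D u v) }

ClosedPath : ∀ {n} → Digraph n → Fin n → List (Fin n) → Set
ClosedPath D first []           = ⊤
ClosedPath D first (v ∷ [])     = Arc D v first
ClosedPath D first (v ∷ w ∷ vs) = Arc D v w × ClosedPath D first (w ∷ vs)

DirectedCycle : ∀ {n} → Digraph n → List (Fin n) → Set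
DirectedCycle D []       = ⊥
DirectedCycle D (v ∷ vs) =
  (2 ≤ length (v ∷ vs)) × Unique (v ∷ vs) × ClosedPath D v (v ∷ vs)

AcyclicColoring : ∀ {n} → Digraph n → (k : ℕ) → (Fin n → Fin k) → Set
AcyclicColoring {n} D k c =
  (i : Fin k) (cyc : List (Fin n)) →
    All (λ v → c v ≡ i) cyc → ¬ DirectedCycle D cyc

HasAcyclicColoring : ∀ {n} → Digraph n → ℕ → Set
HasAcyclicColoring {n} D k = Σ (Fin n → Fin k) (AcyclicColoring D k)

IsDichromaticNumber : ∀ {n} → Digraph n → ℕ → Set
IsDichromaticNumber D k =
  HasAcyclicColoring D k × (∀ j → HasAcyclicColoring D j → k ≤ j)

module Submission where

-- Colour the vertices v₀, v₁, … of D and of Dᶜ greedily and simultaneously.  When v_m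
-- arrives, in D it takes a colour that no earlier out-neighbour carries, if there is one:
-- a cycle through v_m then leaves it along an arc to a differently coloured vertex.
-- Otherwise v_m opens a new colour.  The same is done in Dᶜ.  If the colourings of
-- v₀, …, v_{m-1} use k and l colours and both open a new colour at v_m, then every old
-- colour of D sits on an earlier out-neighbour of v_m and every old colour of Dᶜ on an
-- earlier non-out-neighbour; these witnesses are distinct, so k + l ≤ m.  Hence the
-- invariant k + l ≤ m + 1 survives every step.

open import Defs
open import Data.Nat using (ℕ; zero; suc; _+_; _≤_; _<_; z≤n; s≤s; _<?_)
open import Data.Nat.Properties using (≤-refl; ≤-trans; ≤-reflexive; +-suc; +-mono-≤; m≤n⇒m≤1+n; n≤1+n; <⇒≢; ≤∧≢⇒<; n<1⇒n≡0)
open import Data.Fin as Fin using (Fin; toℕ; fromℕ; fromℕ<; inject₁; splitAt; join)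
open import Data.Fin.Properties using (toℕ-injective; toℕ-fromℕ<; toℕ<n; fromℕ<-injective; fromℕ≢inject₁; inject₁-injective; join-splitAt; injective⇒≤; any?; all?; ¬∀⟶∃¬)
open import Data.Bool using (true) renaming (_≟_ to _≟ᵇ_)
open import Data.Bool.Properties using (not-¬)
open import Data.List using ([]; _∷_)
open import Data.List.Membership.Propositional using (_∈_)
open import Data.List.Relation.Unary.Any using (here; there) renaming (any? to anyᴸ?)
open import Data.List.Relation.Unary.All as All using (All; _∷_)
open import Data.List.Relation.Unary.AllPairs using (_∷_)
open import Data.Vec.Functional using (updateAt)
open import Data.Vec.Functional.Properties using (updateAt-updates; updateAt-minimal)
open import Data.Product using (Σ; _×_; ∃; ∃₂; _,_; proj₁; proj₂)
open import Data.Sum using (_⊎_; inj₁; inj₂; [_,_]′)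
open import Data.Empty using (⊥-elim)
open import Function using (_∘_; const)
open import Relation.Nullary using (¬_; Dec; yes; no)
open import Relation.Nullary.Decidable using (_×-dec_; ¬?; decidable-stable)
open import Relation.Binary.PropositionalEquality using (_≡_; _≢_; refl; sym; trans; cong; subst)

private
  variable
    n k l m : ℕ

closedPath-successor : ∀ {G : Digraph n} {first x vs} → ClosedPath G first vs → x ∈ vs →
  ∃ λ w → Arc G x w × (w ∈ vs ⊎ w ≡ first)
closedPath-successor {vs = v ∷ []}     x→first (here refl) = _ , x→first , inj₂ refl
closedPath-successor {vs = v ∷ w ∷ vs} (v→w , _) (here refl) = w , v→w , inj₁ (there (here refl))
closedPath-successor {vs = v ∷ w ∷ vs} (_ , path) (there x∈)
  with closedPath-successor path x∈
... | y , x→y , inj₁ y∈ = y , x→y , inj₁ (there y∈)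
... | y , x→y , inj₂ y≡first = y , x→y , inj₂ y≡first

directedCycle-successor : ∀ {G : Digraph n} {x cyc} → DirectedCycle G cyc → x ∈ cyc →
  ∃ λ w → Arc G x w × w ∈ cyc
directedCycle-successor {cyc = v ∷ vs} (_ , _ , path) x∈ with closedPath-successor path x∈
... | w , x→w , inj₁ w∈ = w , x→w , w∈
... | w , x→w , inj₂ refl = w , x→w , here refl

CyclesPolychromaticBelow : Digraph n → ℕ → (Fin n → Fin k) → Set
CyclesPolychromaticBelow {n} G m c = ∀ cyc → DirectedCycle G cyc → All (λ v → toℕ v < m) cyc →
  ∃₂ λ u w → u ∈ cyc × w ∈ cyc × c u ≢ c w

PolychromaticColouring : Digraph n → ℕ → ℕ → Set
PolychromaticColouring {n} G m k = Σ (Fin n → Fin k) (CyclesPolychromaticBelow G m)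

cyclesPolychromaticBelow-1 : ∀ (G : Digraph n) (c : Fin n → Fin k) → CyclesPolychromaticBelow G 1 c
cyclesPolychromaticBelow-1 G c (_ ∷ []) (s≤s () , _) _
cyclesPolychromaticBelow-1 G c (u ∷ w ∷ _) (_ , ((u≢w ∷ _) ∷ _) , _) (u<1 ∷ w<1 ∷ _) =
  ⊥-elim (u≢w (toℕ-injective (trans (n<1⇒n≡0 u<1) (sym (n<1⇒n≡0 w<1)))))

cyclesPolychromaticBelow⇒acyclic : ∀ {G : Digraph n} {c : Fin n → Fin k} →
  CyclesPolychromaticBelow G n c → AcyclicColoring G k c
cyclesPolychromaticBelow⇒acyclic poly i cyc monochromatic isCycle
  with poly cyc isCycle (All.tabulate λ {v} _ → toℕ<n v)
... | u , w , u∈ , w∈ , cu≢cw =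
  cu≢cw (trans (All.lookup monochromatic u∈) (sym (All.lookup monochromatic w∈)))

below⇒≢ : ∀ {x v : Fin n} → toℕ x ≡ m → toℕ v < m → v ≢ x
below⇒≢ x≡m v<m refl = <⇒≢ v<m x≡m

below-suc⇒below : ∀ {x v : Fin n} → toℕ x ≡ m → toℕ v < suc m → v ≢ x → toℕ v < m
below-suc⇒below x≡m (s≤s v≤m) v≢x = ≤∧≢⇒< v≤m (λ v≡m → v≢x (toℕ-injective (trans v≡m (sym x≡m))))

cyclesPolychromaticBelow-suc : ∀ {G : Digraph n} {x} {c : Fin n → Fin k} {c′ : Fin n → Fin l} →
  toℕ x ≡ m → CyclesPolychromaticBelow G m c →
  (∀ u v → u ≢ x → v ≢ x → c′ u ≡ c′ v → c u ≡ c v) →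
  (∀ w → toℕ w < m → adj G x w ≡ true → c′ w ≢ c′ x) →
  CyclesPolychromaticBelow G (suc m) c′
cyclesPolychromaticBelow-suc {x = x} x≡m poly refines separated cyc isCycle below
  with anyᴸ? (x Fin.≟_) cyc
... | yes x∈ =
  let w , (x≢w , x→w) , w∈ = directedCycle-successor isCycle x∈
      w<m = below-suc⇒below x≡m (All.lookup below w∈) (x≢w ∘ sym)
  in x , w , x∈ , w∈ , separated w w<m x→w ∘ sym
... | no x∉ =
  let ≢x : ∀ {v} → v ∈ cyc → v ≢ x
      ≢x v∈ v≡x = x∉ (subst (_∈ cyc) v≡x v∈)
      u , w , u∈ , w∈ , cu≢cw = poly cyc isCycle
        (All.tabulate λ v∈ → below-suc⇒below x≡m (All.lookup below v∈) (≢x v∈))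
  in u , w , u∈ , w∈ , cu≢cw ∘ refines u w (≢x u∈) (≢x w∈)

Blocks : Digraph n → ℕ → Fin n → (Fin n → Fin k) → Fin k → Fin n → Set
Blocks G m x c i u = toℕ u < m × adj G x u ≡ true × c u ≡ i

blocks? : ∀ (G : Digraph n) m x (c : Fin n → Fin k) i u → Dec (Blocks G m x c i u)
blocks? G m x c i u = (toℕ u <? m) ×-dec (adj G x u ≟ᵇ true) ×-dec (c u Fin.≟ i)

AllColoursBlocked : Digraph n → ℕ → Fin n → (Fin n → Fin k) → Set
AllColoursBlocked {k = k} G m x c = ∀ (i : Fin k) → ∃ (Blocks G m x c i)

unblockedColour-or-allColoursBlocked : ∀ (G : Digraph n) m x (c : Fin n → Fin k) →
  (∃ λ i → ∀ u → ¬ Blocks G m x c i u) ⊎ AllColoursBlocked G m x c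
unblockedColour-or-allColoursBlocked {n} G m x c
  with any? (λ i → all? λ u → ¬? (blocks? G m x c i u))
... | yes unblocked = inj₁ unblocked
... | no none = inj₂ λ i →
  let u , ¬¬blocks = ¬∀⟶∃¬ n _ (λ u → ¬? (blocks? G m x c i u)) (λ free → none (i , free))
  in u , decidable-stable (blocks? G m x c i u) ¬¬blocks

cyclesPolychromaticBelow-assign : ∀ {G : Digraph n} {x} {c : Fin n → Fin k} {i} →
  toℕ x ≡ m → CyclesPolychromaticBelow G m c → (∀ u → ¬ Blocks G m x c i u) →
  CyclesPolychromaticBelow G (suc m) (updateAt c x (const i))
cyclesPolychromaticBelow-assign {m = m} {G = G} {x} {c} {i} x≡m poly unblocked =
  cyclesPolychromaticBelow-suc x≡m poly refines separated
  where
  c′ : Fin _ → Fin _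
  c′ = updateAt c x (const i)
  refines : ∀ u v → u ≢ x → v ≢ x → c′ u ≡ c′ v → c u ≡ c v
  refines u v u≢x v≢x e = trans (sym (updateAt-minimal u x c u≢x)) (trans e (updateAt-minimal v x c v≢x))
  separated : ∀ w → toℕ w < m → adj G x w ≡ true → c′ w ≢ c′ x
  separated w w<m x→w e =
    unblocked w (w<m , x→w ,
      trans (sym (updateAt-minimal w x c (below⇒≢ x≡m w<m))) (trans e (updateAt-updates x c)))

cyclesPolychromaticBelow-fresh : ∀ {G : Digraph n} {x} {c : Fin n → Fin k} →
  toℕ x ≡ m → CyclesPolychromaticBelow G m c →
  CyclesPolychromaticBelow G (suc m) (updateAt (inject₁ ∘ c) x (const (fromℕ k)))
cyclesPolychromaticBelow-fresh {k = k} {m} {G} {x} {c} x≡m poly =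
  cyclesPolychromaticBelow-suc x≡m poly refines separated
  where
  c′ : Fin _ → Fin (suc k)
  c′ = updateAt (inject₁ ∘ c) x (const (fromℕ k))
  refines : ∀ u v → u ≢ x → v ≢ x → c′ u ≡ c′ v → c u ≡ c v
  refines u v u≢x v≢x e = inject₁-injective
    (trans (sym (updateAt-minimal u x _ u≢x)) (trans e (updateAt-minimal v x _ v≢x)))
  separated : ∀ w → toℕ w < m → adj G x w ≡ true → c′ w ≢ c′ x
  separated w w<m _ e = fromℕ≢inject₁
    (sym (trans (sym (updateAt-minimal w x _ (below⇒≢ x≡m w<m))) (trans e (updateAt-updates x _))))

extendPolychromaticColouring : ∀ {G : Digraph n} {x} → toℕ x ≡ m → PolychromaticColouring G m k →
  PolychromaticColouring G (suc m) k ⊎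
  (PolychromaticColouring G (suc m) (suc k) × Σ (Fin n → Fin k) (AllColoursBlocked G m x))
extendPolychromaticColouring {G = G} {x} x≡m (c , poly)
  with unblockedColour-or-allColoursBlocked G _ x c
... | inj₁ (i , unblocked) = inj₁ (_ , cyclesPolychromaticBelow-assign x≡m poly unblocked)
... | inj₂ allBlocked = inj₂ ((_ , cyclesPolychromaticBelow-fresh x≡m poly) , c , allBlocked)

injective-below⇒≤ : ∀ (f : Fin k → Fin n) → (∀ i → toℕ (f i) < m) →
  (∀ {i j} → f i ≡ f j → i ≡ j) → k ≤ m
injective-below⇒≤ f below f-injective = injective⇒≤ {f = λ i → fromℕ< (below i)} λ {i} {j} e →
  f-injective (toℕ-injective (fromℕ<-injective _ _ (below i) (below j) e))

allColoursBlocked⇒+≤ : ∀ {D : Digraph n} {x} {c : Fin n → Fin k} {d : Fin n → Fin l} →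
  AllColoursBlocked D m x c → AllColoursBlocked (complement D) m x d → k + l ≤ m
allColoursBlocked⇒+≤ {n} {k} {l} {m} blockedD blockedDᶜ =
  injective-below⇒≤ (witness ∘ splitAt k) (below ∘ splitAt k)
    (splitAt-injective ∘ witness-injective)
  where
  witness : Fin k ⊎ Fin l → Fin n
  witness = [ proj₁ ∘ blockedD , proj₁ ∘ blockedDᶜ ]′
  below : ∀ s → toℕ (witness s) < m
  below (inj₁ i) = proj₁ (proj₂ (blockedD i))
  below (inj₂ j) = proj₁ (proj₂ (blockedDᶜ j))
  witness-injective : ∀ {s t} → witness s ≡ witness t → s ≡ t
  witness-injective {inj₁ i} {inj₁ i′} e with blockedD i | blockedD i′ | e
  ... | _ , _ , _ , ci | _ , _ , _ , ci′ | refl = cong inj₁ (trans (sym ci) ci′)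
  witness-injective {inj₂ j} {inj₂ j′} e with blockedDᶜ j | blockedDᶜ j′ | e
  ... | _ , _ , _ , dj | _ , _ , _ , dj′ | refl = cong inj₂ (trans (sym dj) dj′)
  witness-injective {inj₁ i} {inj₂ j} e with blockedD i | blockedDᶜ j | e
  ... | _ , _ , x→u , _ | _ , _ , x↛u , _ | refl = ⊥-elim (not-¬ refl (trans x→u (sym x↛u)))
  witness-injective {inj₂ j} {inj₁ i} e with blockedD i | blockedDᶜ j | e
  ... | _ , _ , x→u , _ | _ , _ , x↛u , _ | refl = ⊥-elim (not-¬ refl (trans x→u (sym x↛u)))
  splitAt-injective : ∀ {a b} → splitAt k a ≡ splitAt k b → a ≡ b
  splitAt-injective {a} {b} e =
    trans (sym (join-splitAt k l a)) (trans (cong (join k l) e) (join-splitAt k l b))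

record ColouringPair (D : Digraph n) (m : ℕ) : Set where
  field
    {colours coColours} : ℕ
    colouring   : PolychromaticColouring D m colours
    coColouring : PolychromaticColouring (complement D) m coColours
    bound       : colours + coColours ≤ suc m

colouringPair-suc : ∀ {D : Digraph n} {x} → toℕ x ≡ m → ColouringPair D m → ColouringPair D (suc m)
colouringPair-suc {D = D} {x} x≡m pair
  with extendPolychromaticColouring {G = D} x≡m (ColouringPair.colouring pair)
     | extendPolychromaticColouring {G = complement D} x≡m (ColouringPair.coColouring pair)
     | ColouringPair.bound pair
... | inj₁ c | inj₁ d | k+l≤ = record { colouring = c ; coColouring = d ; bound = m≤n⇒m≤1+n k+l≤ }
... | inj₁ c | inj₂ (d , _) | k+l≤ =
  record { colouring = c ; coColouring = d ; bound = ≤-trans (≤-reflexive (+-suc _ _)) (s≤s k+l≤) }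
... | inj₂ (c , _) | inj₁ d | k+l≤ = record { colouring = c ; coColouring = d ; bound = s≤s k+l≤ }
... | inj₂ (c , _ , blockedD) | inj₂ (d , _ , blockedDᶜ) | _ =
  record { colouring = c ; coColouring = d
         ; bound = s≤s (≤-trans (≤-reflexive (+-suc _ _))
                                (s≤s (allColoursBlocked⇒+≤ {D = D} blockedD blockedDᶜ))) }

colouringPair : ∀ (D : Digraph n) m → m < n → ColouringPair D (suc m)
colouringPair {suc n} D zero _ = record
  { colours     = 1
  ; coColours   = 1
  ; colouring   = const Fin.zero , cyclesPolychromaticBelow-1 D _
  ; coColouring = const Fin.zero , cyclesPolychromaticBelow-1 (complement D) _
  ; bound       = ≤-refl
  }
colouringPair D (suc m) m<n =
  colouringPair-suc (toℕ-fromℕ< m<n) (colouringPair D m (≤-trans (n≤1+n _) m<n))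

mainTheorem4 : (n : ℕ) (D : Digraph n) (a b : ℕ) →
    IsDichromaticNumber D a → IsDichromaticNumber (complement D) b →
    a + b ≤ suc n
mainTheorem4 zero D a b (_ , minimalD) (_ , minimalDᶜ) =
  ≤-trans (+-mono-≤ (minimalD 0 ((λ ()) , λ ())) (minimalDᶜ 0 ((λ ()) , λ ()))) z≤n
mainTheorem4 (suc n) D a b (_ , minimalD) (_ , minimalDᶜ) =
  ≤-trans (+-mono-≤ (minimalD _ (c , cyclesPolychromaticBelow⇒acyclic polyD))
                    (minimalDᶜ _ (d , cyclesPolychromaticBelow⇒acyclic polyDᶜ)))
          bound
  where
  open ColouringPair (colouringPair D n ≤-refl)
  c = proj₁ colouring
  polyD = proj₂ colouring
  d = proj₁ coColouring
  polyDᶜ = proj₂ coColouring
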